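{- For every graph $G$, $\gamma_{3{\rm rt}}(G)\ge \frac{3}{2}\gamma(G)$, and this inequality is tight: there exist graphs $G$ with $\gamma_{3{\rm rt}}(G)=\frac{3}{2}\gamma(G)$.
   Context: All graphs are finite, simple and undirected; $N(v)$ denotes the open neighborhood of $v$. $\gamma(G)$ is the domination number. A $3$-rainbow total dominating function of $G$ is a function $f:V(G)\to 2^{\{1,2,3\}}$ such that (i) every vertex $v$ with $f(v)=\emptyset$ satisfies $\bigcup_{u\in N(v)}f(u)=\{1,2,3\}$, and (ii) for every vertex $v$ with $f(v)=\{i\}$ there is $u\in N(v)$ with $i\in f(u)$. Its weight is $\sum_v|f(v)|$ and $\gamma_{3{\rm rt}}(G)$ is the minimum weight of such a function. -}

module Defs where

open import Data.Nat using (ℕ; _≤_)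
open import Data.Bool using (Bool; T; false)
open import Data.Fin using (Fin)
open import Data.Fin.Subset using (Subset; _∈_; ∣_∣; ⁅_⁆) renaming (⊥ to ∅)
open import Data.Vec using (tabulate; sum)
open import Data.Product using (∃; _×_)
open import Data.Sum using (_⊎_)
open import Relation.Binary.PropositionalEquality using (_≡_)

record Graph (n : ℕ) : Set where
  field
    adj     : Fin n → Fin n → Bool
    symm    : ∀ u v → adj u v ≡ adj v u
    irrefl  : ∀ v → adj v v ≡ false
open Graph public

Adj : ∀ {n} → Graph n → Fin n → Fin n → Set
Adj G u v = T (adj G u v)

IsDominating : ∀ {n} → Graph n → Subset n → Set
IsDominating {n} G D = ∀ (v : Fin n) → v ∈ D ⊎ ∃ λ u → Adj G v u × u ∈ D

IsDominationNumber : ∀ {n} → Graph n → ℕ → Set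
IsDominationNumber {n} G k =
  (∃ λ (D : Subset n) → IsDominating G D × ∣ D ∣ ≡ k)
  × (∀ (D : Subset n) → IsDominating G D → k ≤ ∣ D ∣)

-- Functions f : V(G) → 2^{1,2,3}; the colour set {1,2,3} is represented by Fin 3.
Colouring : ℕ → Set
Colouring n = Fin n → Subset 3

Is3RTDF : ∀ {n} → Graph n → Colouring n → Set
Is3RTDF {n} G f =
  (∀ (v : Fin n) → f v ≡ ∅ → ∀ (i : Fin 3) → ∃ λ u → Adj G v u × i ∈ f u)
  × (∀ (v : Fin n) (i : Fin 3) → f v ≡ ⁅ i ⁆ → ∃ λ u → Adj G v u × i ∈ f u)

weight : ∀ {n} → Colouring n → ℕ
weight f = sum (tabulate (λ v → ∣ f v ∣))

Is3RTDNumber : ∀ {n} → Graph n → ℕ → Set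
Is3RTDNumber {n} G k =
  (∃ λ (f : Colouring n) → Is3RTDF G f × weight f ≡ k)
  × (∀ (f : Colouring n) → Is3RTDF G f → k ≤ weight f)

-- Let f be a 3-rainbow total dominating function (3RTDF) and
-- call a label rich if it has at least two colours.  A vertex labelled {c}
-- has a neighbour whose label contains c, and that label is rich or equal
-- to {c}.  So every singleton-labelled vertex without a rich neighbour has a
-- neighbour with the same label, and a generalised Ore lemma (obtained from
-- a removal-minimal dominating set) gives a set A such that A and its
-- complement both dominate these vertices in the equal-label graph.  For a
-- colour k let D k consist of the rich vertices, the vertices whose label
-- contains k, the vertices of A whose label contains k+1 and the vertices
-- outside A whose label contains k+2.  Each D k dominates G, and a vertex v
-- lies in at most 2·|f(v)| of the three sets, whence
--   3·γ(G) ≤ |D 0| + |D 1| + |D 2| ≤ 2·w(f).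
--
-- Three disjoint edges joined to the eight vertices of a cube
-- give a 14-vertex graph with γ = 4 (no dominating set of size < 4, by
-- exhaustive search) carrying a 3RTDF of weight 6; the lower bound then
-- shows γ_{3rt} = 6.
module Submission where

open import Defs
open import Level using (0ℓ)
open import Function using (_∘_; const)
open import Data.Empty using (⊥-elim)
open import Data.Unit using (tt)
open import Data.Bool using (Bool; true; false; T)
open import Data.Bool.Properties using () renaming (_≟_ to _≟ᵇ_)
open import Data.Nat using (ℕ; zero; suc; _+_; _*_; _≤_; _<_; _≤?_; _<?_; z≤n; s≤s)
open import Data.Nat.Properties using (≤-trans; +-mono-≤; *-distribˡ-+; *-cancelˡ-≤; ≮⇒≥; module ≤-Reasoning)
open import Data.Nat.Induction using (<-wellFounded)
open import Data.Nat.Solver using (module +-*-Solver)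
open import Data.Product using (Σ; ∃; _×_; _,_; proj₁; proj₂)
open import Data.Sum using (_⊎_; inj₁; inj₂)
open import Data.Fin using (Fin; zero; suc; #_) renaming (_≟_ to _≟ᶠ_)
open import Data.Fin.Properties using (all?; any?; ¬∀⟶∃¬)
open import Data.Fin.Subset using (Subset; _∈_; _∉_; _-_; _∪_; ∣_∣; ⁅_⁆) renaming (⊥ to ∅; ⊤ to Full)
open import Data.Fin.Subset.Properties using (_∈?_; ∈⊤; x∈⁅x⁆; x∈p∧x≢y⇒x∈p-y; x∈p⇒∣p-x∣<∣p∣; anySubset?)
open import Data.Vec using (Vec; []; _∷_; _++_; lookup; tabulate; sum; replicate)
open import Data.Vec.Properties using (≡-dec; lookup⇒[]=; lookup∘tabulate)
open import Induction.WellFounded using (Acc; acc)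
open import Relation.Unary using (Pred; Decidable)
open import Relation.Nullary using (Dec; yes; no; does; ¬_)
open import Relation.Nullary.Negation using (contradiction)
open import Relation.Nullary.Decidable using (_×-dec_; _⊎-dec_; _→-dec_; ¬?; T?; toWitness; from-no; dec-true; dec-false; decidable-stable)
open import Relation.Binary.PropositionalEquality using (_≡_; refl; sym; trans; cong₂; subst)

_≟ₛ_ : ∀ {n} (p q : Subset n) → Dec (p ≡ q)
_≟ₛ_ = ≡-dec _≟ᵇ_

adj-sym : ∀ {n} (G : Graph n) {u v} → Adj G u v → Adj G v u
adj-sym G {u} {v} = subst T (symm G u v)

adj-irrefl : ∀ {n} (G : Graph n) {v} → ¬ Adj G v v
adj-irrefl G {v} = subst T (irrefl G v)

-- v is dominated by X: it belongs to X or has an R-neighbour in X.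
-- IsDominating G D unfolds to  ∀ v → Dominated (Adj G) (_∈ D) v.
Dominated : ∀ {n} → (Fin n → Fin n → Set) → Pred (Fin n) 0ℓ → Pred (Fin n) 0ℓ
Dominated R X v = X v ⊎ ∃ λ u → R v u × X u

Dominated-mono : ∀ {n} {R : Fin n → Fin n → Set} {X Y : Pred (Fin n) 0ℓ} →
                 (∀ {u} → X u → Y u) → ∀ {v} → Dominated R X v → Dominated R Y v
Dominated-mono X⊆Y (inj₁ xv)            = inj₁ (X⊆Y xv)
Dominated-mono X⊆Y (inj₂ (u , vRu , xu)) = inj₂ (u , vRu , X⊆Y xu)

dominated? : ∀ {n} {R : Fin n → Fin n → Set} {X : Pred (Fin n) 0ℓ} →
             (∀ u v → Dec (R u v)) → Decidable X → Decidable (Dominated R X)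
dominated? R? X? v = X? v ⊎-dec any? (λ u → R? v u ×-dec X? u)

isDominating? : ∀ {n} (G : Graph n) (D : Subset n) → Dec (IsDominating G D)
isDominating? G D = all? (dominated? {R = Adj G} (λ u v → T? (adj G u v)) (_∈? D))

removal-minimal : ∀ {n} {P : Pred (Subset n) 0ℓ} → Decidable P → ∀ p → P p →
                  ∃ λ q → P q × (∀ {x} → x ∈ q → ¬ P (q - x))
removal-minimal {P = P} P? p Pp = shrink p Pp (<-wellFounded ∣ p ∣)
  where
  shrink : ∀ p → P p → Acc _<_ ∣ p ∣ → ∃ λ q → P q × (∀ {x} → x ∈ q → ¬ P (q - x))
  shrink p Pp (acc smaller) with any? (λ x → x ∈? p ×-dec P? (p - x))
  ... | yes (x , x∈p , Pp-x) = shrink (p - x) Pp-x (smaller (x∈p⇒∣p-x∣<∣p∣ x∈p))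
  ... | no cannot-shrink     = p , Pp , λ x∈p Pp-x → cannot-shrink (_ , x∈p , Pp-x)

module Ore {n} {_~_ : Fin n → Fin n → Set} (_~?_ : ∀ u v → Dec (u ~ v))
           (~-sym : ∀ {u v} → u ~ v → v ~ u) (~-irrefl : ∀ {v} → ¬ v ~ v) where

  ~⇒≢ : ∀ {u v} → u ~ v → ¬ u ≡ v
  ~⇒≢ u~v refl = ~-irrefl u~v

  -- If X dominates w but X - x does not, then x was w's only dominator in
  -- X, so w is x itself or one of its neighbours.
  only-dominator : ∀ {X x w} → Dominated _~_ (_∈ X) w → ¬ Dominated _~_ (_∈ X - x) w →
                   w ≡ x ⊎ w ~ x
  only-dominator {x = x} {w} (inj₁ w∈X) ¬dom with w ≟ᶠ x
  ... | yes w≡x = inj₁ w≡x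
  ... | no w≢x  = contradiction (inj₁ (x∈p∧x≢y⇒x∈p-y w∈X w≢x)) ¬dom
  only-dominator {x = x} (inj₂ (u , w~u , u∈X)) ¬dom with u ≟ᶠ x
  ... | yes refl = inj₂ w~u
  ... | no u≢x   = contradiction (inj₂ (u , w~u , x∈p∧x≢y⇒x∈p-y u∈X u≢x)) ¬dom

  -- If every vertex of T has a neighbour, some set A and its complement both
  -- dominate T.  (For T = all vertices this is Ore's theorem.)  A is a
  -- removal-minimal set dominating T; each v ∈ A is needed by some w ∈ T,
  -- and w is then v's neighbour outside A or v has one.
  ore : ∀ {T : Pred (Fin n) 0ℓ} → Decidable T → (∀ {v} → T v → ∃ (v ~_)) →
        ∃ λ A → ∀ {v} → T v → Dominated _~_ (_∈ A) v × Dominated _~_ (_∉ A) v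
  ore {T} T? neighbour = A , λ tv → A-dominates _ tv , complement-dominates tv
    where
    Dominates : Pred (Subset n) 0ℓ
    Dominates X = ∀ v → T v → Dominated _~_ (_∈ X) v

    dominates? : Decidable Dominates
    dominates? X = all? λ v → T? v →-dec dominated? _~?_ (_∈? X) v

    minimal : ∃ λ A → Dominates A × (∀ {x} → x ∈ A → ¬ Dominates (A - x))
    minimal = removal-minimal dominates? Full (λ v _ → inj₁ ∈⊤)

    A : Subset n
    A = proj₁ minimal

    A-dominates : Dominates A
    A-dominates = proj₁ (proj₂ minimal)

    needed : ∀ {v} → v ∈ A → ∃ λ w → T w × ¬ Dominated _~_ (_∈ A - v) w
    needed v∈A with ¬∀⟶∃¬ n _ (λ w → T? w →-dec dominated? _~?_ (_∈? A - _) w)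
                                (proj₂ (proj₂ minimal) v∈A)
    ... | w , ¬[tw→dom] =
      w , decidable-stable (T? w) (λ ¬tw → ¬[tw→dom] (⊥-elim ∘ ¬tw)) , ¬[tw→dom] ∘ const

    -- v ∉ A dominates itself; for v ∈ A the target w needing v is v itself
    -- (then v's neighbour lies outside A) or a neighbour of v outside A.
    complement-dominates : ∀ {v} → T v → Dominated _~_ (_∉ A) v
    complement-dominates {v} tv with v ∈? A
    ... | no v∉A = inj₁ v∉A
    ... | yes v∈A with needed v∈A
    ...   | w , tw , ¬dom with only-dominator (A-dominates w tw) ¬dom
    ...     | inj₁ refl with neighbour tv
    ...       | u , v~u = inj₂ (u , v~u , λ u∈A →
                  ¬dom (inj₂ (u , v~u , x∈p∧x≢y⇒x∈p-y u∈A (~⇒≢ v~u ∘ sym))))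
    complement-dominates tv | yes v∈A | w , tw , ¬dom | inj₂ w~v =
      inj₂ (w , ~-sym w~v , λ w∈A → ¬dom (inj₁ (x∈p∧x≢y⇒x∈p-y w∈A (~⇒≢ w~v))))

-- A decidable property of subsets holds for all of them unless a
-- counterexample is found; evaluation of this decision proves the finite
-- facts below.
allSubsets? : ∀ {n} {P : Pred (Subset n) 0ℓ} → Decidable P → Dec (∀ p → P p)
allSubsets? P? with anySubset? (¬? ∘ P?)
... | yes (p , ¬Pp) = no λ all → ¬Pp (all p)
... | no none       = yes λ p → decidable-stable (P? p) (λ ¬Pp → none (p , ¬Pp))

Rich : Subset 3 → Set
Rich s = 2 ≤ ∣ s ∣

label-shape : ∀ (s : Subset 3) → s ≡ ∅ ⊎ (∃ λ c → s ≡ ⁅ c ⁆) ⊎ Rich s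
label-shape = toWitness {a? = allSubsets? λ s →
  (s ≟ₛ ∅) ⊎-dec any? (λ c → s ≟ₛ ⁅ c ⁆) ⊎-dec (2 ≤? ∣ s ∣)} tt

singleton-or-rich : ∀ (s : Subset 3) c → c ∈ s → s ≡ ⁅ c ⁆ ⊎ Rich s
singleton-or-rich = toWitness {a? = allSubsets? λ s → all? λ c →
  c ∈? s →-dec (s ≟ₛ ⁅ c ⁆ ⊎-dec 2 ≤? ∣ s ∣)} tt

next : Fin 3 → Fin 3
next zero             = suc zero
next (suc zero)       = suc (suc zero)
next (suc (suc zero)) = zero

-- shift a k is the colour whose singleton-labelled vertices on side a of the
-- Ore partition are added to D k: k+1 for side true, k+2 for side false.
shift : Bool → Fin 3 → Fin 3
shift true  = next
shift false = next ∘ next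

colour-trichotomy : ∀ k c → c ≡ k ⊎ c ≡ shift true k ⊎ c ≡ shift false k
colour-trichotomy = toWitness {a? = all? λ k → all? λ c →
  c ≟ᶠ k ⊎-dec c ≟ᶠ shift true k ⊎-dec c ≟ᶠ shift false k} tt

-- A vertex with label s on side a belongs to D k.
Member : Fin 3 → Subset 3 → Bool → Set
Member k s a = Rich s ⊎ k ∈ s ⊎ shift a k ∈ s

member? : ∀ k s a → Dec (Member k s a)
member? k s a = 2 ≤? ∣ s ∣ ⊎-dec k ∈? s ⊎-dec shift a k ∈? s

ι : Bool → ℕ
ι true  = 1
ι false = 0

-- A vertex with label s lies in at most 2·|s| of the three sets: a singleton
-- in exactly two, a rich vertex in all three.
member-count : ∀ a (s : Subset 3) →
  ι (does (member? (# 0) s a)) + ι (does (member? (# 1) s a)) + ι (does (member? (# 2) s a))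
    ≤ 2 * ∣ s ∣
member-count true  = toWitness {a? = allSubsets? λ s → _ ≤? _} tt
member-count false = toWitness {a? = allSubsets? λ s → _ ≤? _} tt

subsetOf : ∀ {n} {P : Pred (Fin n) 0ℓ} → Decidable P → Subset n
subsetOf P? = tabulate (does ∘ P?)

∈-subsetOf : ∀ {n} {P : Pred (Fin n) 0ℓ} (P? : Decidable P) {v} → P v → v ∈ subsetOf P?
∈-subsetOf P? {v} pv = lookup⇒[]= v _ (trans (lookup∘tabulate (does ∘ P?) v) (dec-true (P? v) pv))

∣∷∣ : ∀ {n} b (p : Subset n) → ∣ b ∷ p ∣ ≡ ι b + ∣ p ∣
∣∷∣ true  p = refl
∣∷∣ false p = refl

open +-*-Solver using (solve; _:+_; _:*_; _:=_; con)

three-subsets-bound : ∀ {n} m (p q r : Fin n → Bool) (w : Fin n → ℕ) →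
  (∀ i → ι (p i) + ι (q i) + ι (r i) ≤ m * w i) →
  ∣ tabulate p ∣ + ∣ tabulate q ∣ + ∣ tabulate r ∣ ≤ m * sum (tabulate w)
three-subsets-bound {zero}  m p q r w bound = z≤n
three-subsets-bound {suc n} m p q r w bound = begin
  ∣ tabulate p ∣ + ∣ tabulate q ∣ + ∣ tabulate r ∣
    ≡⟨ cong₂ _+_ (cong₂ _+_ (∣∷∣ (p zero) P) (∣∷∣ (q zero) Q)) (∣∷∣ (r zero) R) ⟩
  (ι (p zero) + ∣ P ∣) + (ι (q zero) + ∣ Q ∣) + (ι (r zero) + ∣ R ∣)
    ≡⟨ regroup (ι (p zero)) (∣ P ∣) (ι (q zero)) (∣ Q ∣) (ι (r zero)) (∣ R ∣) ⟩
  (ι (p zero) + ι (q zero) + ι (r zero)) + (∣ P ∣ + ∣ Q ∣ + ∣ R ∣)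
    ≤⟨ +-mono-≤ (bound zero)
         (three-subsets-bound m (p ∘ suc) (q ∘ suc) (r ∘ suc) (w ∘ suc) (bound ∘ suc)) ⟩
  m * w zero + m * sum (tabulate (w ∘ suc))
    ≡⟨ *-distribˡ-+ m (w zero) _ ⟨
  m * sum (tabulate w) ∎
  where
  open ≤-Reasoning
  P Q R : Subset n
  P = tabulate (p ∘ suc)
  Q = tabulate (q ∘ suc)
  R = tabulate (r ∘ suc)
  regroup : ∀ a x b y c z → (a + x) + (b + y) + (c + z) ≡ (a + b + c) + (x + y + z)
  regroup = solve 6 (λ a x b y c z →
    (a :+ x) :+ (b :+ y) :+ (c :+ z) := (a :+ b :+ c) :+ (x :+ y :+ z)) refl

three-lower : ∀ {d a b c} → d ≤ a → d ≤ b → d ≤ c → 3 * d ≤ a + b + c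
three-lower {d} {a} {b} {c} d≤a d≤b d≤c = begin
  3 * d      ≡⟨ triple d ⟩
  d + d + d  ≤⟨ +-mono-≤ (+-mono-≤ d≤a d≤b) d≤c ⟩
  a + b + c  ∎
  where
  open ≤-Reasoning
  triple : ∀ x → 3 * x ≡ x + x + x
  triple = solve 1 (λ x → con 3 :* x := x :+ x :+ x) refl

module ThreeDominatingSets {n} (G : Graph n) (f : Colouring n) (isF : Is3RTDF G f) where

  _≈_ : Fin n → Fin n → Set
  u ≈ v = Adj G u v × f u ≡ f v

  _≈?_ : ∀ u v → Dec (u ≈ v)
  u ≈? v = T? (adj G u v) ×-dec (f u ≟ₛ f v)

  ≈-sym : ∀ {u v} → u ≈ v → v ≈ u
  ≈-sym (u~v , fu≡fv) = adj-sym G u~v , sym fu≡fv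

  ≈-irrefl : ∀ {v} → ¬ v ≈ v
  ≈-irrefl (v~v , _) = adj-irrefl G v~v

  -- A rich neighbour lies in every D k, so such vertices need no further care.
  HasRichNeighbour : Pred (Fin n) 0ℓ
  HasRichNeighbour v = ∃ λ u → Adj G v u × Rich (f u)

  hasRichNeighbour? : Decidable HasRichNeighbour
  hasRichNeighbour? v = any? λ u → T? (adj G v u) ×-dec 2 ≤? ∣ f u ∣

  -- Singleton-labelled vertices without a rich neighbour: they must be
  -- dominated through the equal-label graph.
  Lonely : Pred (Fin n) 0ℓ
  Lonely v = (∃ λ c → f v ≡ ⁅ c ⁆) × ¬ HasRichNeighbour v

  lonely? : Decidable Lonely
  lonely? v = any? (λ c → f v ≟ₛ ⁅ c ⁆) ×-dec ¬? (hasRichNeighbour? v)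

  -- Condition (ii) of a 3RTDF gives a lonely vertex an equal-label neighbour.
  lonely-neighbour : ∀ {v} → Lonely v → ∃ (v ≈_)
  lonely-neighbour {v} ((c , fv≡c) , no-rich) with proj₂ isF v c fv≡c
  ... | u , v~u , c∈fu with singleton-or-rich (f u) c c∈fu
  ...   | inj₁ fu≡c = u , v~u , trans fv≡c (sym fu≡c)
  ...   | inj₂ rich = contradiction (u , v~u , rich) no-rich

  partition : ∃ λ A → ∀ {v} → Lonely v → Dominated _≈_ (_∈ A) v × Dominated _≈_ (_∉ A) v
  partition = Ore.ore _≈?_ ≈-sym ≈-irrefl lonely? lonely-neighbour

  side : Fin n → Bool
  side v = does (v ∈? proj₁ partition)

  both-sides : ∀ {v} → Lonely v → ∀ a → Dominated _≈_ (λ u → side u ≡ a) v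
  both-sides lonely true  = Dominated-mono {R = _≈_} (λ {u} → dec-true (u ∈? _)) (proj₁ (proj₂ partition lonely))
  both-sides lonely false = Dominated-mono {R = _≈_} (λ {u} → dec-false (u ∈? _)) (proj₂ (proj₂ partition lonely))

  D : Fin 3 → Subset n
  D k = subsetOf (λ v → member? k (f v) (side v))

  ∈D : ∀ {k v} → Member k (f v) (side v) → v ∈ D k
  ∈D {k} = ∈-subsetOf (λ v → member? k (f v) (side v))

  shifted∈D : ∀ {k v a} → f v ≡ ⁅ shift a k ⁆ → side v ≡ a → v ∈ D k
  shifted∈D {k} {v} {a} fv≡ refl = ∈D (inj₂ (inj₂ (subst (shift a k ∈_) (sym fv≡) (x∈⁅x⁆ _))))

  lonely-dominated : ∀ {k v} a → Lonely v → f v ≡ ⁅ shift a k ⁆ → Dominated (Adj G) (_∈ D k) v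
  lonely-dominated a lonely fv≡ with both-sides lonely a
  ... | inj₁ side≡a                       = inj₁ (shifted∈D fv≡ side≡a)
  ... | inj₂ (u , (v~u , fv≡fu) , side≡a) = inj₂ (u , v~u , shifted∈D (trans (sym fv≡fu) fv≡) side≡a)

  -- A singleton-labelled vertex is dominated by D k: by a rich neighbour if it
  -- has one, by itself if its colour is k, and otherwise via the Ore partition.
  singleton-dominated : ∀ k {v c} → f v ≡ ⁅ c ⁆ → Dominated (Adj G) (_∈ D k) v
  singleton-dominated k {v} {c} fv≡c with hasRichNeighbour? v
  ... | yes (u , v~u , rich) = inj₂ (u , v~u , ∈D (inj₁ rich))
  ... | no no-rich with colour-trichotomy k c
  ...   | inj₁ refl        = inj₁ (∈D (inj₂ (inj₁ (subst (c ∈_) (sym fv≡c) (x∈⁅x⁆ c)))))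
  ...   | inj₂ (inj₁ refl) = lonely-dominated true  ((c , fv≡c) , no-rich) fv≡c
  ...   | inj₂ (inj₂ refl) = lonely-dominated false ((c , fv≡c) , no-rich) fv≡c

  -- Empty labels see colour k on a neighbour (condition (i)); rich vertices
  -- belong to every D k.
  D-dominating : ∀ k → IsDominating G (D k)
  D-dominating k v with label-shape (f v)
  ... | inj₁ fv≡∅ with proj₁ isF v fv≡∅ k
  ...   | u , v~u , k∈fu = inj₂ (u , v~u , ∈D (inj₂ (inj₁ k∈fu)))
  D-dominating k v | inj₂ (inj₁ (c , fv≡c)) = singleton-dominated k fv≡c
  D-dominating k v | inj₂ (inj₂ rich)       = inj₁ (∈D (inj₁ rich))

  D-sizes : ∣ D (# 0) ∣ + ∣ D (# 1) ∣ + ∣ D (# 2) ∣ ≤ 2 * weight f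
  D-sizes = three-subsets-bound 2 _ _ _ _ (λ v → member-count (side v) (f v))

domination-bound : ∀ {n} (G : Graph n) {d} → (∀ D → IsDominating G D → d ≤ ∣ D ∣) →
                   ∀ {f} → Is3RTDF G f → 3 * d ≤ 2 * weight f
domination-bound G lower {f} isF =
  ≤-trans (three-lower (lower _ (D-dominating (# 0))) (lower _ (D-dominating (# 1)))
                       (lower _ (D-dominating (# 2))))
          D-sizes
  where open ThreeDominatingSets G f isF

is3RTDF? : ∀ {n} (G : Graph n) (f : Colouring n) → Dec (Is3RTDF G f)
is3RTDF? G f =
  (all? λ v → (f v ≟ₛ ∅) →-dec all? (sees? v))
  ×-dec (all? λ v → all? λ i → (f v ≟ₛ ⁅ i ⁆) →-dec sees? v i)
  where
  sees? : ∀ v i → Dec (∃ λ u → Adj G v u × i ∈ f u)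
  sees? v i = any? λ u → T? (adj G v u) ×-dec i ∈? f u

pattern ● = true
pattern · = false

-- Vertices 0–5 form the disjoint edges {0,1}, {2,3}, {4,5}; vertex 6 + x,
-- where x = x₀ + 2x₁ + 4x₂ with xᵢ ∈ {0,1}, is adjacent to 2i + xᵢ for each
-- i < 3 (a cube vertex sees one end of each edge).
cube-matrix : Vec (Vec Bool 14) 14
cube-matrix =
  (· ∷ ● ∷ · ∷ · ∷ · ∷ · ∷ ● ∷ · ∷ ● ∷ · ∷ ● ∷ · ∷ ● ∷ · ∷ []) ∷
  (● ∷ · ∷ · ∷ · ∷ · ∷ · ∷ · ∷ ● ∷ · ∷ ● ∷ · ∷ ● ∷ · ∷ ● ∷ []) ∷
  (· ∷ · ∷ · ∷ ● ∷ · ∷ · ∷ ● ∷ ● ∷ · ∷ · ∷ ● ∷ ● ∷ · ∷ · ∷ []) ∷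
  (· ∷ · ∷ ● ∷ · ∷ · ∷ · ∷ · ∷ · ∷ ● ∷ ● ∷ · ∷ · ∷ ● ∷ ● ∷ []) ∷
  (· ∷ · ∷ · ∷ · ∷ · ∷ ● ∷ ● ∷ ● ∷ ● ∷ ● ∷ · ∷ · ∷ · ∷ · ∷ []) ∷
  (· ∷ · ∷ · ∷ · ∷ ● ∷ · ∷ · ∷ · ∷ · ∷ · ∷ ● ∷ ● ∷ ● ∷ ● ∷ []) ∷
  (● ∷ · ∷ ● ∷ · ∷ ● ∷ · ∷ · ∷ · ∷ · ∷ · ∷ · ∷ · ∷ · ∷ · ∷ []) ∷
  (· ∷ ● ∷ ● ∷ · ∷ ● ∷ · ∷ · ∷ · ∷ · ∷ · ∷ · ∷ · ∷ · ∷ · ∷ []) ∷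
  (● ∷ · ∷ · ∷ ● ∷ ● ∷ · ∷ · ∷ · ∷ · ∷ · ∷ · ∷ · ∷ · ∷ · ∷ []) ∷
  (· ∷ ● ∷ · ∷ ● ∷ ● ∷ · ∷ · ∷ · ∷ · ∷ · ∷ · ∷ · ∷ · ∷ · ∷ []) ∷
  (● ∷ · ∷ ● ∷ · ∷ · ∷ ● ∷ · ∷ · ∷ · ∷ · ∷ · ∷ · ∷ · ∷ · ∷ []) ∷
  (· ∷ ● ∷ ● ∷ · ∷ · ∷ ● ∷ · ∷ · ∷ · ∷ · ∷ · ∷ · ∷ · ∷ · ∷ []) ∷
  (● ∷ · ∷ · ∷ ● ∷ · ∷ ● ∷ · ∷ · ∷ · ∷ · ∷ · ∷ · ∷ · ∷ · ∷ []) ∷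
  (· ∷ ● ∷ · ∷ ● ∷ · ∷ ● ∷ · ∷ · ∷ · ∷ · ∷ · ∷ · ∷ · ∷ · ∷ []) ∷ []

cubeGraph : Graph 14
cubeGraph = record
  { adj    = λ u v → lookup (lookup cube-matrix u) v
  ; symm   = toWitness {a? = all? λ u → all? λ v → _ ≟ᵇ _} tt
  ; irrefl = toWitness {a? = all? λ v → _ ≟ᵇ false} tt
  }

-- Vertices 0 and 1 dominate the first edge and the whole cube; 2 and 4
-- dominate the other two edges.
cube-dominating-set : Subset 14
cube-dominating-set = ⁅ # 0 ⁆ ∪ ⁅ # 1 ⁆ ∪ ⁅ # 2 ⁆ ∪ ⁅ # 4 ⁆

no-small-dominating-set : ¬ (∃ λ D → ∣ D ∣ < 4 × IsDominating cubeGraph D)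
no-small-dominating-set = from-no (anySubset? λ D → ∣ D ∣ <? 4 ×-dec isDominating? cubeGraph D)

cube-γ : IsDominationNumber cubeGraph 4
cube-γ = (cube-dominating-set , toWitness {a? = isDominating? cubeGraph cube-dominating-set} tt , refl)
       , λ D dom → ≮⇒≥ (λ small → no-small-dominating-set (D , small , dom))

-- Colour i+1 on both ends of edge i, nothing on the cube.
cube-labelling : Colouring 14
cube-labelling = lookup ((⁅ # 0 ⁆ ∷ ⁅ # 0 ⁆ ∷ ⁅ # 1 ⁆ ∷ ⁅ # 1 ⁆ ∷ ⁅ # 2 ⁆ ∷ ⁅ # 2 ⁆ ∷ []) ++ replicate 8 ∅)

-- γ_{3rt}(cubeGraph) = 6: the labelling above has weight 6, and every 3RTDF
-- has weight at least (3/2)·γ = 6 by the lower bound.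
cube-γ3rt : Is3RTDNumber cubeGraph 6
cube-γ3rt = (cube-labelling , toWitness {a? = is3RTDF? cubeGraph cube-labelling} tt , refl)
          , λ f isF → *-cancelˡ-≤ 2 (domination-bound cubeGraph (proj₂ cube-γ) isF)

corollary12 :
    (∀ (n : ℕ) (G : Graph n) (k d : ℕ) →
       Is3RTDNumber G k → IsDominationNumber G d → 3 * d ≤ 2 * k)
    × (Σ ℕ λ n → 1 ≤ n × Σ (Graph n) λ G → Σ ℕ λ k → Σ ℕ λ d →
         Is3RTDNumber G k × IsDominationNumber G d × 2 * k ≡ 3 * d)
corollary12 = lower-bound , (14 , s≤s z≤n , cubeGraph , 6 , 4 , cube-γ3rt , cube-γ , refl)
  where
  lower-bound : ∀ (n : ℕ) (G : Graph n) (k d : ℕ) →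
                Is3RTDNumber G k → IsDominationNumber G d → 3 * d ≤ 2 * k
  lower-bound n G k d ((f , isF , w≡k) , _) (_ , lower) =
    subst (λ w → 3 * d ≤ 2 * w) w≡k (domination-bound G lower isF)
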